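{- Let integers $P>Q\ge 1$ and positive integers $a,b,c,d$ be such that $a<b<c<d\le 2a$ and the integers $k_1a+k_2b+k_3c+k_4d$, over all tuples with $k_1,k_2\in\mathbb{Z}\cap[-3P,3P]$, $k_3\in\mathbb{Z}\cap[0,2Q]$, $k_4\in\{0,1\}$, are pairwise distinct. Let $M=Pa+Qc+d$, and for integers $0\le i\le P$, $0\le j\le Q$ let $S_{i,j}$ be the multiset of object sizes consisting of $i$ objects of size $a$, $j$ objects of size $c$, $h$ objects of size $b$ where $h=\lfloor(M-d-ia-jc)/b\rfloor$, and one further object (the finger object) of size $M-ia-jc-hb$. Then for every sub-multiset $X$ of $S_{i,j}$ there exists a unique tuple $(k_1,k_2,k_3,k_4)$ with $k_1\in\mathbb{Z}\cap[0,2P]$, $k_2\in\mathbb{Z}\cap[-3P,3P]$, $k_3\in\mathbb{Z}\cap[0,2Q]$, $k_4\in\{0,1\}$ such that the sum of $X$ equals $k_1a+k_2b+k_3c+k_4d$. Moreover, $k_4=1$ if and only if $X$ contains the finger object of $S_{i,j}$.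
   Context: The finger object's size lies in $[d,d+b)$, so it differs from $a,b,c$; the multiset $S_{i,j}$ is regarded as a collection of objects with one distinguished (finger) object, and its total size is $M$. -}

module Defs where

open import Data.Nat as ℕ using (ℕ; zero; suc; _∸_; _≤_; _<_)
open import Data.Nat.DivMod using (_/_)
open import Data.Integer as ℤ using (ℤ; +_; -_)
open import Data.Product using (_×_; _,_)
open import Data.Sum using (_⊎_)
open import Data.List using (List; []; _∷_; _++_; replicate; map)
open import Data.Nat.ListAction using (sum)
open import Relation.Binary.PropositionalEquality using (_≡_)

data Obj : Set where
  objA objB objC finger : Obj

Tuple : Set
Tuple = ℤ × ℤ × ℤ × ℤ

lin : ℕ → ℕ → ℕ → ℕ → Tuple → ℤ
lin a b c d (k₁ , k₂ , k₃ , k₄) =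
  k₁ ℤ.* + a ℤ.+ k₂ ℤ.* + b ℤ.+ k₃ ℤ.* + c ℤ.+ k₄ ℤ.* + d

_∈[_,_] : ℤ → ℤ → ℤ → Set
x ∈[ lo , hi ] = lo ℤ.≤ x × x ℤ.≤ hi

HypBox : ℕ → ℕ → Tuple → Set
HypBox P Q (k₁ , k₂ , k₃ , k₄) =
  k₁ ∈[ - (+ (3 ℕ.* P)) , + (3 ℕ.* P) ] ×
  k₂ ∈[ - (+ (3 ℕ.* P)) , + (3 ℕ.* P) ] ×
  k₃ ∈[ + 0 , + (2 ℕ.* Q) ] ×
  (k₄ ≡ + 0 ⊎ k₄ ≡ + 1)

ConclBox : ℕ → ℕ → Tuple → Set
ConclBox P Q (k₁ , k₂ , k₃ , k₄) =
  k₁ ∈[ + 0 , + (2 ℕ.* P) ] ×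
  k₂ ∈[ - (+ (3 ℕ.* P)) , + (3 ℕ.* P) ] ×
  k₃ ∈[ + 0 , + (2 ℕ.* Q) ] ×
  (k₄ ≡ + 0 ⊎ k₄ ≡ + 1)

fourth : Tuple → ℤ
fourth (_ , _ , _ , k₄) = k₄

-- floor division; b is positive in the lemma, the zero case is unused
floorDiv : ℕ → ℕ → ℕ
floorDiv m zero = zero
floorDiv m (suc k) = m / suc k

bigM : ℕ → ℕ → ℕ → ℕ → ℕ → ℕ
bigM P Q a c d = P ℕ.* a ℕ.+ Q ℕ.* c ℕ.+ d

hCount : ℕ → ℕ → ℕ → ℕ → ℕ → ℕ → ℕ → ℕ → ℕ
hCount P Q a b c d i j = floorDiv (bigM P Q a c d ∸ d ∸ i ℕ.* a ∸ j ℕ.* c) b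

fingerSize : ℕ → ℕ → ℕ → ℕ → ℕ → ℕ → ℕ → ℕ → ℕ
fingerSize P Q a b c d i j =
  bigM P Q a c d ∸ i ℕ.* a ∸ j ℕ.* c ∸ hCount P Q a b c d i j ℕ.* b

size : ℕ → ℕ → ℕ → ℕ → ℕ → ℕ → ℕ → ℕ → Obj → ℕ
size P Q a b c d i j objA = a
size P Q a b c d i j objB = b
size P Q a b c d i j objC = c
size P Q a b c d i j finger = fingerSize P Q a b c d i j

S : ℕ → ℕ → ℕ → ℕ → ℕ → ℕ → ℕ → ℕ → List Obj
S P Q a b c d i j =
  replicate i objA ++ replicate j objC ++
  replicate (hCount P Q a b c d i j) objB ++ finger ∷ []

total : ℕ → ℕ → ℕ → ℕ → ℕ → ℕ → ℕ → ℕ → List Obj → ℕ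
total P Q a b c d i j X = sum (map (size P Q a b c d i j) X)

{-# OPTIONS --safe #-}
module Submission where

-- A sub-multiset of S_{i,j} consists of x ≤ i objects of size a, y ≤ h of size b,
-- z ≤ j of size c and possibly the finger. Without the finger its sum has
-- coordinates (x, y, z, 0). With r = (P − i)a + (Q − j)c the finger has size
-- r + d − hb, so with it the sum has coordinates (x + P − i, −(h − y), z + Q − j, 1).
-- As c < d ≤ 2a < 2b, hb ≤ r ≤ 3Pb, so h ≤ 3P and both tuples lie in the box of
-- the conclusion; that box lies inside the one on which the coordinates are
-- injective, which gives uniqueness.

open import Defs
open import Data.Nat using (ℕ; _≤_; _<_; _*_)
open import Data.Integer using (+_)
open import Data.List using (List)
open import Data.Product using (Σ; _×_)
open import Data.List.Membership.Propositional using (_∈_)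
open import Data.List.Relation.Binary.Sublist.Propositional using (_⊆_)
open import Relation.Binary.PropositionalEquality using (_≡_)
open import Function.Bundles using (_⇔_)

open import Data.Nat using (zero; suc; _+_; _∸_; z≤n; s≤s; NonZero; >-nonZero)
open import Data.Nat.Properties
  using (≤-trans; ≤-reflexive; <⇒≤; <-≤-trans; m≤n⇒m≤1+n; m≤m+n; m≤n*m; +-assoc; +-identityʳ;
         +-mono-≤; +-monoˡ-≤; *-mono-≤; *-monoˡ-≤; *-monoʳ-≤; *-cancelʳ-≤;
         ∸-+-assoc; m∸n≤m; m+n∸n≡m; m∸n+n≡m; m+[n∸m]≡n)
open import Data.Nat.DivMod using (_/_; m/n*n≤m)
open import Data.Nat.ListAction using (sum)
import Data.Integer as ℤ
open import Data.Integer using (+≤+)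
open import Data.Integer.Properties using (neg-≤-pos; neg-mono-≤; pos-+; pos-*)
  renaming (≤-trans to ℤ-≤-trans)
open import Data.List using ([]; _∷_; _++_; replicate; map)
open import Data.List.Membership.Propositional using (_∉_)
open import Data.List.Membership.Propositional.Properties using (∈-++⁺ʳ)
open import Data.List.Relation.Unary.Any using (here)
open import Data.List.Relation.Unary.All using ([])
open import Data.List.Relation.Unary.All.Properties using (All¬⇒¬Any; ++⁺; replicate⁺)
open import Data.List.Relation.Binary.Sublist.Heterogeneous using ([]; _∷_; _∷ʳ_)
open import Data.Product using (∃; ∃₂; _,_)
open import Data.Sum using (inj₁; inj₂)
open import Function.Bundles using (mk⇔)
open import Relation.Nullary using (contradiction)
open import Relation.Binary.PropositionalEquality using (refl; sym; trans; cong; cong₂; subst; module ≡-Reasoning)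
import Data.Nat.Tactic.RingSolver as ℕ-Solver
import Data.Integer.Tactic.RingSolver as ℤ-Solver

module _ {ℓ} {A : Set ℓ} where

  ⊆-replicate⁻ : ∀ n {o : A} {xs} → xs ⊆ replicate n o → ∃ λ m → m ≤ n × xs ≡ replicate m o
  ⊆-replicate⁻ zero    []       = 0 , z≤n , refl
  ⊆-replicate⁻ (suc n) (_ ∷ʳ p) with ⊆-replicate⁻ n p
  ... | m , m≤n , refl = m , m≤n⇒m≤1+n m≤n , refl
  ⊆-replicate⁻ (suc n) (refl ∷ p) with ⊆-replicate⁻ n p
  ... | m , m≤n , refl = suc m , s≤s m≤n , refl

  ⊆-replicate-++⁻ : ∀ n {o : A} {xs ys} → xs ⊆ replicate n o ++ ys →
                    ∃₂ λ m xs′ → m ≤ n × xs′ ⊆ ys × xs ≡ replicate m o ++ xs′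
  ⊆-replicate-++⁻ zero    p        = 0 , _ , z≤n , p , refl
  ⊆-replicate-++⁻ (suc n) (_ ∷ʳ p) with ⊆-replicate-++⁻ n p
  ... | m , xs′ , m≤n , q , refl = m , xs′ , m≤n⇒m≤1+n m≤n , q , refl
  ⊆-replicate-++⁻ (suc n) (refl ∷ p) with ⊆-replicate-++⁻ n p
  ... | m , xs′ , m≤n , q , refl = suc m , xs′ , s≤s m≤n , q , refl

  sum-map-replicate : ∀ (f : A → ℕ) n o → sum (map f (replicate n o)) ≡ n * f o
  sum-map-replicate f zero    o = refl
  sum-map-replicate f (suc n) o = cong (_+_ (f o)) (sum-map-replicate f n o)

  sum-map-replicate-++ : ∀ (f : A → ℕ) n o ys →
                         sum (map f (replicate n o ++ ys)) ≡ n * f o + sum (map f ys)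
  sum-map-replicate-++ f zero    o ys = refl
  sum-map-replicate-++ f (suc n) o ys =
    trans (cong (_+_ (f o)) (sum-map-replicate-++ f n o ys)) (sym (+-assoc (f o) _ _))

-- Listed in the order of S, so that S P Q a b c d i j is selection i h j 1 by definition.
selection : (x y z e : ℕ) → List Obj
selection x y z e = replicate x objA ++ replicate z objC ++ replicate y objB ++ replicate e finger

data SubSelection (x y z e : ℕ) : List Obj → Set where
  selected : ∀ {x′ y′ z′ e′} → x′ ≤ x → y′ ≤ y → z′ ≤ z → e′ ≤ e →
             SubSelection x y z e (selection x′ y′ z′ e′)

⊆-selection⁻ : ∀ {x y z e X} → X ⊆ selection x y z e → SubSelection x y z e X
⊆-selection⁻ {x} {y} {z} {e} X⊆ with ⊆-replicate-++⁻ x X⊆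
... | _ , _ , x′≤x , X₁⊆ , refl with ⊆-replicate-++⁻ z X₁⊆
... | _ , _ , z′≤z , X₂⊆ , refl with ⊆-replicate-++⁻ y X₂⊆
... | _ , _ , y′≤y , X₃⊆ , refl with ⊆-replicate⁻ e X₃⊆
... | _ , e′≤e , refl = selected x′≤x y′≤y z′≤z e′≤e

sum-map-selection : ∀ (σ : Obj → ℕ) x y z e →
  sum (map σ (selection x y z e)) ≡ x * σ objA + y * σ objB + z * σ objC + e * σ finger
sum-map-selection σ x y z e = begin
  sum (map σ (selection x y z e))
    ≡⟨ sum-map-replicate-++ σ x objA _ ⟩
  x * σ objA + sum (map σ (replicate z objC ++ replicate y objB ++ replicate e finger))
    ≡⟨ cong (_+_ (x * σ objA)) (sum-map-replicate-++ σ z objC _) ⟩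
  x * σ objA + (z * σ objC + sum (map σ (replicate y objB ++ replicate e finger)))
    ≡⟨ cong (λ s → x * σ objA + (z * σ objC + s)) (sum-map-replicate-++ σ y objB _) ⟩
  x * σ objA + (z * σ objC + (y * σ objB + sum (map σ (replicate e finger))))
    ≡⟨ cong (λ s → x * σ objA + (z * σ objC + (y * σ objB + s))) (sum-map-replicate σ e finger) ⟩
  x * σ objA + (z * σ objC + (y * σ objB + e * σ finger))
    ≡⟨ regroup x y z e (σ objA) (σ objB) (σ objC) (σ finger) ⟩
  x * σ objA + y * σ objB + z * σ objC + e * σ finger ∎
  where
  open ≡-Reasoning
  regroup : ∀ x y z e α β γ φ → x * α + (z * γ + (y * β + e * φ)) ≡ x * α + y * β + z * γ + e * φ
  regroup = ℕ-Solver.solve-∀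

finger∉selection : ∀ x y z → finger ∉ selection x y z 0
finger∉selection x y z =
  All¬⇒¬Any (++⁺ (replicate⁺ x λ ()) (++⁺ (replicate⁺ z λ ()) (++⁺ (replicate⁺ y λ ()) [])))

finger∈selection : ∀ x y z → finger ∈ selection x y z 1
finger∈selection x y z =
  ∈-++⁺ʳ (replicate x objA) (∈-++⁺ʳ (replicate z objC) (∈-++⁺ʳ (replicate y objB) (here refl)))

lin-pos : ∀ a b c d k₁ k₂ k₃ k₄ →
          + (k₁ * a + k₂ * b + k₃ * c + k₄ * d) ≡ lin a b c d (+ k₁ , + k₂ , + k₃ , + k₄)
lin-pos a b c d k₁ k₂ k₃ k₄ =
  trans (pos-+ _ (k₄ * d)) (cong₂ ℤ._+_
    (trans (pos-+ _ (k₃ * c)) (cong₂ ℤ._+_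
      (trans (pos-+ (k₁ * a) (k₂ * b)) (cong₂ ℤ._+_ (pos-* k₁ a) (pos-* k₂ b)))
      (pos-* k₃ c)))
    (pos-* k₄ d))

lin-pos-negᵇ : ∀ a b c d n k₁ u k₃ k₄ → n + u * b ≡ k₁ * a + k₃ * c + k₄ * d →
               + n ≡ lin a b c d (+ k₁ , ℤ.- + u , + k₃ , + k₄)
lin-pos-negᵇ a b c d n k₁ u k₃ k₄ eq = begin
  + n
    ≡⟨ add-sub (+ n) (+ u ℤ.* + b) ⟩
  + n ℤ.+ + u ℤ.* + b ℤ.- + u ℤ.* + b
    ≡⟨ cong (ℤ._- + u ℤ.* + b) (begin
         + n ℤ.+ + u ℤ.* + b                   ≡⟨ cong (ℤ._+_ (+ n)) (sym (pos-* u b)) ⟩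
         + n ℤ.+ + (u * b)                     ≡⟨ sym (pos-+ n (u * b)) ⟩
         + (n + u * b)                         ≡⟨ cong +_ eq ⟩
         + (k₁ * a + k₃ * c + k₄ * d)          ≡⟨ cong (λ s → + (s + k₃ * c + k₄ * d)) (sym (+-identityʳ _)) ⟩
         + (k₁ * a + 0 * b + k₃ * c + k₄ * d)  ≡⟨ lin-pos a b c d k₁ 0 k₃ k₄ ⟩
         lin a b c d (+ k₁ , + 0 , + k₃ , + k₄) ∎) ⟩
  lin a b c d (+ k₁ , + 0 , + k₃ , + k₄) ℤ.- + u ℤ.* + b
    ≡⟨ move-to-b (+ k₁) (+ u) (+ k₃) (+ k₄) (+ a) (+ b) (+ c) (+ d) ⟩
  lin a b c d (+ k₁ , ℤ.- + u , + k₃ , + k₄) ∎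
  where
  open ≡-Reasoning
  add-sub : ∀ m n → m ≡ m ℤ.+ n ℤ.- n
  add-sub = ℤ-Solver.solve-∀
  move-to-b : ∀ k₁ u k₃ k₄ a b c d →
    k₁ ℤ.* a ℤ.+ + 0 ℤ.* b ℤ.+ k₃ ℤ.* c ℤ.+ k₄ ℤ.* d ℤ.- u ℤ.* b ≡
    k₁ ℤ.* a ℤ.+ (ℤ.- u) ℤ.* b ℤ.+ k₃ ℤ.* c ℤ.+ k₄ ℤ.* d
  move-to-b = ℤ-Solver.solve-∀

m≤n⇒m+[o∸n]≤o : ∀ {m n o} → m ≤ n → n ≤ o → m + (o ∸ n) ≤ o
m≤n⇒m+[o∸n]≤o {n = n} {o} m≤n n≤o = ≤-trans (+-monoˡ-≤ (o ∸ n) m≤n) (≤-reflexive (m+[n∸m]≡n n≤o))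

floorDiv≡/ : ∀ m n .{{_ : NonZero n}} → floorDiv m n ≡ m / n
floorDiv≡/ m (suc n) = refl

m+n+o∸n∸o≡m : ∀ m n o → m + n + o ∸ n ∸ o ≡ m
m+n+o∸n∸o≡m m n o =
  trans (∸-+-assoc (m + n + o) n o) (trans (cong (_∸ (n + o)) (+-assoc m n o)) (m+n∸n≡m m (n + o)))

module SubmultisetSums (P Q a b c d i j : ℕ) .{{_ : NonZero b}} (i≤P : i ≤ P) (j≤Q : j ≤ Q) where

  rest : ℕ
  rest = (P ∸ i) * a + (Q ∸ j) * c

  h : ℕ
  h = hCount P Q a b c d i j

  f : ℕ
  f = fingerSize P Q a b c d i j

  Pa+Qc≡rest+ia+jc : P * a + Q * c ≡ rest + i * a + j * c
  Pa+Qc≡rest+ia+jc = begin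
    P * a + Q * c
      ≡⟨ cong₂ (λ p q → p * a + q * c) (sym (m∸n+n≡m i≤P)) (sym (m∸n+n≡m j≤Q)) ⟩
    (P ∸ i + i) * a + (Q ∸ j + j) * c
      ≡⟨ distribute (P ∸ i) i (Q ∸ j) j a c ⟩
    rest + i * a + j * c ∎
    where
    open ≡-Reasoning
    distribute : ∀ p i q j a c → (p + i) * a + (q + j) * c ≡ p * a + q * c + i * a + j * c
    distribute = ℕ-Solver.solve-∀

  h≡rest/b : h ≡ rest / b
  h≡rest/b = trans (floorDiv≡/ _ b) (cong (_/ b) (begin
    P * a + Q * c + d ∸ d ∸ i * a ∸ j * c
      ≡⟨ cong (λ m → m ∸ i * a ∸ j * c) (m+n∸n≡m (P * a + Q * c) d) ⟩
    P * a + Q * c ∸ i * a ∸ j * c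
      ≡⟨ cong (λ m → m ∸ i * a ∸ j * c) Pa+Qc≡rest+ia+jc ⟩
    rest + i * a + j * c ∸ i * a ∸ j * c
      ≡⟨ m+n+o∸n∸o≡m rest (i * a) (j * c) ⟩
    rest ∎))
    where open ≡-Reasoning

  h*b≤rest : h * b ≤ rest
  h*b≤rest = subst (λ k → k * b ≤ rest) (sym h≡rest/b) (m/n*n≤m rest b)

  f+h*b≡rest+d : f + h * b ≡ rest + d
  f+h*b≡rest+d = begin
    (P * a + Q * c + d ∸ i * a ∸ j * c ∸ h * b) + h * b
      ≡⟨ cong (λ m → m ∸ i * a ∸ j * c ∸ h * b + h * b) M≡ ⟩
    (rest + d + i * a + j * c ∸ i * a ∸ j * c ∸ h * b) + h * b
      ≡⟨ cong (λ m → m ∸ h * b + h * b) (m+n+o∸n∸o≡m (rest + d) (i * a) (j * c)) ⟩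
    (rest + d ∸ h * b) + h * b
      ≡⟨ m∸n+n≡m (≤-trans h*b≤rest (m≤m+n rest d)) ⟩
    rest + d ∎
    where
    open ≡-Reasoning
    swap-d : ∀ r u v d → r + u + v + d ≡ r + d + u + v
    swap-d = ℕ-Solver.solve-∀
    M≡ : P * a + Q * c + d ≡ rest + d + i * a + j * c
    M≡ = trans (cong (_+ d) Pa+Qc≡rest+ia+jc) (swap-d rest (i * a) (j * c) d)

  h≤3P : a < b → c < d → d ≤ 2 * a → Q ≤ P → h ≤ 3 * P
  h≤3P a<b c<d d≤2a Q≤P = *-cancelʳ-≤ h (3 * P) b (≤-trans h*b≤rest rest≤3Pb)
    where
    c≤2b : c ≤ 2 * b
    c≤2b = <⇒≤ (<-≤-trans c<d (≤-trans d≤2a (*-monoʳ-≤ 2 (<⇒≤ a<b))))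
    collect : ∀ P b → P * b + P * (2 * b) ≡ 3 * P * b
    collect = ℕ-Solver.solve-∀
    rest≤3Pb : rest ≤ 3 * P * b
    rest≤3Pb = ≤-trans (+-mono-≤ (*-mono-≤ (m∸n≤m P i) (<⇒≤ a<b))
                                 (*-mono-≤ (≤-trans (m∸n≤m Q j) Q≤P) c≤2b))
                       (≤-reflexive (collect P b))

  Representation : List Obj → Tuple → Set
  Representation X t =
    ConclBox P Q t × + total P Q a b c d i j X ≡ lin a b c d t × (fourth t ≡ + 1 ⇔ finger ∈ X)

  representation-without-finger : ∀ {x y z} → x ≤ i → y ≤ h → z ≤ j → h ≤ 3 * P →
    Representation (selection x y z 0) (+ x , + y , + z , + 0)
  representation-without-finger {x} {y} {z} x≤i y≤h z≤j h≤3P = box , sum≡ , finger⇔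
    where
    box : ConclBox P Q (+ x , + y , + z , + 0)
    box = (+≤+ z≤n , +≤+ (≤-trans x≤i (≤-trans i≤P (m≤n*m P 2)))) ,
          (neg-≤-pos , +≤+ (≤-trans y≤h h≤3P)) ,
          (+≤+ z≤n , +≤+ (≤-trans z≤j (≤-trans j≤Q (m≤n*m Q 2)))) , inj₁ refl
    sum≡ : + total P Q a b c d i j (selection x y z 0) ≡ lin a b c d (+ x , + y , + z , + 0)
    sum≡ = trans (cong +_ (sum-map-selection (size P Q a b c d i j) x y z 0))
                 (lin-pos a b c d x y z 0)
    finger⇔ : + 0 ≡ + 1 ⇔ finger ∈ selection x y z 0
    finger⇔ = mk⇔ (λ ()) (λ f∈ → contradiction f∈ (finger∉selection x y z))

  representation-with-finger : ∀ {x y z} → x ≤ i → y ≤ h → z ≤ j → h ≤ 3 * P →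
    Representation (selection x y z 1) (+ (x + (P ∸ i)) , ℤ.- + (h ∸ y) , + (z + (Q ∸ j)) , + 1)
  representation-with-finger {x} {y} {z} x≤i y≤h z≤j h≤3P = box , sum≡ , finger⇔
    where
    p = P ∸ i
    q = Q ∸ j
    u = h ∸ y
    box : ConclBox P Q (+ (x + p) , ℤ.- + u , + (z + q) , + 1)
    box = (+≤+ z≤n , +≤+ (≤-trans (m≤n⇒m+[o∸n]≤o x≤i i≤P) (m≤n*m P 2))) ,
          (neg-mono-≤ (+≤+ (≤-trans (m∸n≤m h y) h≤3P)) , neg-≤-pos) ,
          (+≤+ z≤n , +≤+ (≤-trans (m≤n⇒m+[o∸n]≤o z≤j j≤Q) (m≤n*m Q 2))) , inj₂ refl
    regroup : ∀ x y z f u a b c →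
              x * a + y * b + z * c + 1 * f + u * b ≡ x * a + z * c + (f + (u + y) * b)
    regroup = ℕ-Solver.solve-∀
    collect : ∀ x z p q a c d →
              x * a + z * c + (p * a + q * c + d) ≡ (x + p) * a + (z + q) * c + 1 * d
    collect = ℕ-Solver.solve-∀
    sum+ub≡ : total P Q a b c d i j (selection x y z 1) + u * b ≡ (x + p) * a + (z + q) * c + 1 * d
    sum+ub≡ = begin
      total P Q a b c d i j (selection x y z 1) + u * b
        ≡⟨ cong (_+ u * b) (sum-map-selection (size P Q a b c d i j) x y z 1) ⟩
      x * a + y * b + z * c + 1 * f + u * b
        ≡⟨ regroup x y z f u a b c ⟩
      x * a + z * c + (f + (u + y) * b)
        ≡⟨ cong (λ k → x * a + z * c + (f + k * b)) (m∸n+n≡m y≤h) ⟩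
      x * a + z * c + (f + h * b)
        ≡⟨ cong (_+_ (x * a + z * c)) f+h*b≡rest+d ⟩
      x * a + z * c + (p * a + q * c + d)
        ≡⟨ collect x z p q a c d ⟩
      (x + p) * a + (z + q) * c + 1 * d ∎
      where open ≡-Reasoning
    sum≡ : + total P Q a b c d i j (selection x y z 1) ≡
           lin a b c d (+ (x + p) , ℤ.- + u , + (z + q) , + 1)
    sum≡ = lin-pos-negᵇ a b c d _ (x + p) u (z + q) 1 sum+ub≡
    finger⇔ : + 1 ≡ + 1 ⇔ finger ∈ selection x y z 1
    finger⇔ = mk⇔ (λ _ → finger∈selection x y z) (λ _ → refl)

  representation : ∀ {x y z e} → x ≤ i → y ≤ h → z ≤ j → e ≤ 1 → h ≤ 3 * P →
    Σ Tuple (Representation (selection x y z e))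
  representation {e = 0} x≤i y≤h z≤j _ h≤3P = _ , representation-without-finger x≤i y≤h z≤j h≤3P
  representation {e = 1} x≤i y≤h z≤j _ h≤3P = _ , representation-with-finger x≤i y≤h z≤j h≤3P
  representation {e = suc (suc _)} _ _ _ (s≤s ()) _

ConclBox⇒HypBox : ∀ P Q t → ConclBox P Q t → HypBox P Q t
ConclBox⇒HypBox P _ _ ((0≤k₁ , k₁≤2P) , k₂∈ , k₃∈ , k₄∈) =
  (ℤ-≤-trans neg-≤-pos 0≤k₁ , ℤ-≤-trans k₁≤2P (+≤+ (*-monoˡ-≤ P (m≤m+n 2 1)))) , k₂∈ , k₃∈ , k₄∈

lemma5p12 : (P Q a b c d : ℕ) → Q < P → 1 ≤ Q → 1 ≤ a →
    a < b → b < c → c < d → d ≤ 2 * a →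
    (∀ (t t′ : Tuple) → HypBox P Q t → HypBox P Q t′ →
      lin a b c d t ≡ lin a b c d t′ → t ≡ t′) →
    (i j : ℕ) → i ≤ P → j ≤ Q →
    (X : List Obj) → X ⊆ S P Q a b c d i j →
    Σ Tuple (λ t →
      (ConclBox P Q t ×
       + total P Q a b c d i j X ≡ lin a b c d t ×
       (fourth t ≡ + 1 ⇔ finger ∈ X)) ×
      (∀ (t′ : Tuple) → ConclBox P Q t′ →
        + total P Q a b c d i j X ≡ lin a b c d t′ → t′ ≡ t))
lemma5p12 P Q a b c d Q<P _ 1≤a a<b _ c<d d≤2a injective i j i≤P j≤Q X X⊆S
  with ⊆-selection⁻ X⊆S
... | selected x≤i y≤h z≤j e≤1 =
  let t , represents@(box , sum≡ , _) =
        representation x≤i y≤h z≤j e≤1 (h≤3P a<b c<d d≤2a (<⇒≤ Q<P))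
  in  t , represents , λ t′ box′ sum≡′ →
        injective t′ t (ConclBox⇒HypBox P Q t′ box′) (ConclBox⇒HypBox P Q t box)
                  (trans (sym sum≡′) sum≡)
  where open SubmultisetSums P Q a b c d i j {{>-nonZero (≤-trans 1≤a (<⇒≤ a<b))}} i≤P j≤Q
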